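{- Let $S\subseteq\mathcal{S}_d$, a partition $G_1,\dots,G_g$ of $[d]$, $\bar{\alpha},\bar{\beta}\in[0,1]^g$ and $k\in[d]$ be given. For each $i$ let $\alpha'_i=|G_i|-\lceil\beta_i k\rceil$ and $\beta'_i=|G_i|-\lfloor\alpha_i k\rfloor$. Let $\tau$ be a bottom-$(d-k)$ ranking (a bijection $\tau:D_\tau\to\{k+1,\dots,d\}$, $D_\tau\subseteq[d]$) such that for each $i$, $D_\tau$ contains at least $\alpha'_i$ and at most $\beta'_i$ elements of $G_i$, and which minimizes $2\sum_{\pi\in S}\sum_{i\in D_\tau}(\tau(i)-\pi(i))\cdot\mathbb{1}_{\pi(i)<\tau(i)}$ among all such bottom-$(d-k)$ rankings. Let $\sigma\in\mathcal{S}_d$ minimize $2\sum_{\pi\in S}\sum_{i\in[d]}(\sigma(i)-\pi(i))\cdot\mathbb{1}_{\pi(i)<\sigma(i)}$ among all rankings with $\sigma(a)=\tau(a)$ for all $a\in D_\tau$. Let $\sigma^*$ be any $(\bar{\alpha},\bar{\beta})$-$k$-fair ranking minimizing $\mathrm{Obj}(S,\cdot)$, $\mathrm{OPT}=\mathrm{Obj}(S,\sigma^*)$, and $R^*$ the set of candidates in positions $k+1,\dots,d$ of $\sigma^*$. Then $\sigma$ is $(\bar{\alpha},\bar{\beta})$-$k$-fair and $$\mathrm{Obj}(S,\sigma)\le 2\sum_{\pi\in S}\sum_{i\in R^*}(\sigma^*(i)-\pi(i))\cdot\mathbb{1}_{\pi(i)<\sigma^*(i)}+\mathrm{OPT}.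$$
   Context: $\mathcal{S}_d$ is the set of rankings (permutations) of $[d]$; $\pi(a)$ is the rank of $a$. A ranking is $(\bar{\alpha},\bar{\beta})$-$k$-fair if for every group $G_i$ its positions $1,\dots,k$ contain at least $\lfloor\alpha_i k\rfloor$ and at most $\lceil\beta_i k\rceil$ candidates of $G_i$. $F(\pi,\sigma)=\sum_{i\in[d]}|\pi(i)-\sigma(i)|$, $\mathrm{Obj}(S,\sigma)=\sum_{\pi\in S}F(\pi,\sigma)$. $\mathbb{1}_E$ is the indicator of $E$.
   Formalization: The parameters $\bar{\alpha},\bar{\beta}$ have rational entries in [0,1]. -}

module Defs where

open import Data.Nat using (ℕ; zero; suc; _+_; _*_; _∸_; _≤_; _<_; ∣_-_∣)
open import Data.Nat.Properties using (_≟_; _<?_; _≤?_)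
open import Data.Fin using (Fin; toℕ)
open import Data.Fin.Permutation using (Permutation′; _⟨$⟩ʳ_)
open import Data.List using (List; map; allFin)
open import Data.Nat.ListAction using (sum)
open import Data.Maybe using (Maybe; just; nothing)
open import Data.Product using (_×_; ∃)
open import Data.Bool using (Bool; true; false; if_then_else_)
open import Relation.Nullary.Decidable using (⌊_⌋)
import Data.Fin.Properties as FinP
open import Relation.Binary.PropositionalEquality using (_≡_)
open import Data.Integer as ℤ using (ℤ; +_)
open import Data.Rational as ℚ using (ℚ)

-- A ranking of [d] is a bijection candidates → positions.
-- Candidates are Fin d; positions are Fin d, 0-based: position p here is
-- position p+1 in the paper.  (Only differences of positions and the
-- predicate "among positions 1..k" are used, so the shift is harmless.)
Ranking : ℕ → Set
Ranking d = Permutation′ d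

rank : ∀ {d} → Ranking d → Fin d → ℕ
rank π a = toℕ (π ⟨$⟩ʳ a)

Σ[d] : (d : ℕ) → (Fin d → ℕ) → ℕ
Σ[d] d f = sum (map f (allFin d))

ΣS : ∀ {d} → List (Ranking d) → (Ranking d → ℕ) → ℕ
ΣS S f = sum (map f S)

𝟙 : Bool → ℕ
𝟙 true  = 1
𝟙 false = 0

F : ∀ {d} → Ranking d → Ranking d → ℕ
F {d} π σ = Σ[d] d (λ i → ∣ rank π i - rank σ i ∣)

Obj : ∀ {d} → List (Ranking d) → Ranking d → ℕ
Obj S σ = ΣS S (λ π → F π σ)

-- Groups: a partition G_1..G_g of [d] is given by a map grp : Fin d → Fin g
-- (G_j = grp⁻¹(j)).
-- |G_j|
groupSize : ∀ {d g} → (Fin d → Fin g) → Fin g → ℕ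
groupSize {d} grp j = Σ[d] d (λ a → 𝟙 ⌊ grp a FinP.≟ j ⌋)

topCount : ∀ {d g} → (Fin d → Fin g) → ℕ → Ranking d → Fin g → ℕ
topCount {d} grp k σ j =
  Σ[d] d (λ a → 𝟙 ⌊ grp a FinP.≟ j ⌋ * 𝟙 ⌊ rank σ a <? k ⌋)

Fair : ∀ {d g} → (Fin d → Fin g) → (α β : Fin g → ℚ) → ℕ → Ranking d → Set
Fair grp α β k σ = ∀ j →
  (ℚ.floor (α j ℚ.* ((+ k) ℚ./ 1)) ℤ.≤ + topCount grp k σ j)
  × (+ topCount grp k σ j ℤ.≤ ℚ.ceiling (β j ℚ.* ((+ k) ℚ./ 1)))

-- A bottom-(d-k) ranking: a bijection τ : D_τ → {k+1,…,d} (0-based: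
-- positions k,…,d-1) with D_τ ⊆ [d].  Represented as a partial map
-- Fin d → Maybe (Fin d); D_τ = {a | τ a ≡ just _}.
record BottomRanking (d k : ℕ) : Set where
  field
    τ          : Fin d → Maybe (Fin d)
    injective  : ∀ a b p → τ a ≡ just p → τ b ≡ just p → a ≡ b
    inBottom   : ∀ a p → τ a ≡ just p → k ≤ toℕ p
    surjective : ∀ (p : Fin d) → k ≤ toℕ p → ∃ λ a → τ a ≡ just p
open BottomRanking public

inD : ∀ {d k} → BottomRanking d k → Fin d → ℕ
inD T a with τ T a
... | just _  = 1
... | nothing = 0

domCount : ∀ {d g k} → (Fin d → Fin g) → BottomRanking d k → Fin g → ℕ
domCount {d} grp T j = Σ[d] d (λ a → 𝟙 ⌊ grp a FinP.≟ j ⌋ * inD T a)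

τCostTerm : ∀ {d k} → BottomRanking d k → Ranking d → Fin d → ℕ
τCostTerm T π a with τ T a
... | just p  = (toℕ p ∸ rank π a) * 𝟙 ⌊ rank π a <? toℕ p ⌋
... | nothing = 0

τCost : ∀ {d k} → List (Ranking d) → BottomRanking d k → ℕ
τCost {d} S T = 2 * ΣS S (λ π → Σ[d] d (τCostTerm T π))

σCost : ∀ {d} → List (Ranking d) → Ranking d → ℕ
σCost {d} S σ = 2 * ΣS S (λ π → Σ[d] d (λ i →
  (rank σ i ∸ rank π i) * 𝟙 ⌊ rank π i <? rank σ i ⌋))

bottomCost : ∀ {d} → List (Ranking d) → ℕ → Ranking d → ℕ
bottomCost {d} S k σ = 2 * ΣS S (λ π → Σ[d] d (λ i →
  𝟙 ⌊ k ≤? rank σ i ⌋ * ((rank σ i ∸ rank π i) * 𝟙 ⌊ rank π i <? rank σ i ⌋)))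

α′ : ∀ {d g} → (Fin d → Fin g) → (β : Fin g → ℚ) → ℕ → Fin g → ℤ
α′ grp β k j = + groupSize grp j ℤ.- ℚ.ceiling (β j ℚ.* ((+ k) ℚ./ 1))

β′ : ∀ {d g} → (Fin d → Fin g) → (α : Fin g → ℚ) → ℕ → Fin g → ℤ
β′ grp α k j = + groupSize grp j ℤ.- ℚ.floor (α j ℚ.* ((+ k) ℚ./ 1))

TauFeasible : ∀ {d g k} → (Fin d → Fin g) → (α β : Fin g → ℚ) →
              BottomRanking d k → Set
TauFeasible {k = k} grp α β T = ∀ j →
  (α′ grp β k j ℤ.≤ + domCount grp T j) × (+ domCount grp T j ℤ.≤ β′ grp α k j)

Extends : ∀ {d k} → Ranking d → BottomRanking d k → Set
Extends {d} σ T = ∀ (a : Fin d) p → τ T a ≡ just p → σ ⟨$⟩ʳ a ≡ p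

-- Σ_i |π(i) − ρ(i)| is twice the total lateness Σ_i (ρ(i) − π(i))⁺, because π and ρ use
-- every position exactly once; hence Obj(S, ρ) is the σ-cost of ρ.  An extension σ of τ has
-- bottom D_τ, so its top-k group counts are |G_j| minus those of D_τ and the constraints on τ
-- are exactly k-fairness of σ; for the same reason the bottom part τ* of σ* is a feasible
-- bottom ranking, whose τ-cost is the first summand of the bound.  Rearranging the top k of σ
-- in the order of σ* yields another extension σ′ of τ in which no top candidate comes later
-- than in σ*, so σCost(σ′) ≤ τCost(τ) + σCost(σ*).  Minimality of σ and then of τ gives
-- Obj(S, σ) ≤ τCost(τ*) + Obj(S, σ*).

module Submission where

open import Defs
open import Data.Nat using (ℕ; _+_; _*_; _≤_)
open import Data.Fin using (Fin)
open import Data.List using (List)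
open import Data.Product using (_×_)
open import Data.Rational using (ℚ; 0ℚ; 1ℚ)
open import Data.Rational as ℚ using ()

open import Data.Bool using (true; false)
open import Data.Fin as Fin using (toℕ; fromℕ<; punchOut)
open import Data.Fin.Permutation using (Permutation′; _⟨$⟩ʳ_; _⟨$⟩ˡ_; inverseʳ; permutation)
open import Data.Fin.Properties
  using (toℕ<n; toℕ-fromℕ<; toℕ-injective; any?; injective⇒≤; punchOut-injective)
open import Data.Integer using (ℤ)
import Data.Integer as ℤ
import Data.Integer.Properties as ℤₚ
open import Data.Integer.Tactic.RingSolver using (solve-∀)
open import Data.List using ([]; _∷_; map; allFin; tabulate)
open import Data.List.Membership.Propositional using (_∈_)
open import Data.List.Membership.Propositional.Properties using (∈-allFin)
open import Data.List.Properties using (map-cong; map-tabulate)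
open import Data.List.Relation.Unary.Any using (here; there)
open import Data.Maybe using (Maybe; just; nothing)
open import Data.Nat using (zero; suc; _∸_; _<_; z≤n; s≤s; s<s; s<s⁻¹; ∣_-_∣)
open import Data.Nat.ListAction using (sum)
open import Data.Nat.Properties
open import Data.Product using (_,_; proj₁; proj₂; ∃)
open import Function using (_∘_; _⇔_; mk⇔; Equivalence; Injective)
open import Function.Properties.Inverse using (↔⇒↣)
open import Function.Bundles using (Injection)
open import Relation.Binary using (tri<; tri≈; tri>)
open import Relation.Binary.PropositionalEquality
open import Relation.Nullary using (Dec; yes; no; ¬_)
open import Relation.Nullary.Decidable using (⌊_⌋)
open import Relation.Nullary.Negation using (contradiction)

open import Algebra.Properties.CommutativeMonoid.Sum +-0-commutativeMonoid
  using (sum-cong-≗; sum-permute) renaming (sum to ∑)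
open import Algebra.Properties.CommutativeSemigroup +-commutativeSemigroup
  using () renaming (interchange to +-interchange)

module _ {A : Set} where

  sum-map-cong : (xs : List A) {f g : A → ℕ} → (∀ x → f x ≡ g x) →
                 sum (map f xs) ≡ sum (map g xs)
  sum-map-cong xs f≗g = cong sum (map-cong f≗g xs)

  sum-map-mono : (xs : List A) {f g : A → ℕ} → (∀ x → f x ≤ g x) →
                 sum (map f xs) ≤ sum (map g xs)
  sum-map-mono []       f≤g = z≤n
  sum-map-mono (x ∷ xs) f≤g = +-mono-≤ (f≤g x) (sum-map-mono xs f≤g)

  sum-map-< : (xs : List A) {f g : A → ℕ} {y : A} → (∀ x → f x ≤ g x) →
              y ∈ xs → f y < g y → sum (map f xs) < sum (map g xs)
  sum-map-< (x ∷ xs) f≤g (here refl) fy<gy = +-mono-<-≤ fy<gy (sum-map-mono xs f≤g)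
  sum-map-< (x ∷ xs) f≤g (there y∈xs) fy<gy = +-mono-≤-< (f≤g x) (sum-map-< xs f≤g y∈xs fy<gy)

  sum-map-+ : (xs : List A) (f g : A → ℕ) →
              sum (map (λ x → f x + g x) xs) ≡ sum (map f xs) + sum (map g xs)
  sum-map-+ []       f g = refl
  sum-map-+ (x ∷ xs) f g =
    trans (cong (f x + g x +_) (sum-map-+ xs f g)) (+-interchange (f x) (g x) _ _)

  sum-map-*ˡ : (xs : List A) (c : ℕ) (f : A → ℕ) →
               sum (map (λ x → c * f x) xs) ≡ c * sum (map f xs)
  sum-map-*ˡ []       c f = sym (*-zeroʳ c)
  sum-map-*ˡ (x ∷ xs) c f =
    trans (cong (c * f x +_) (sum-map-*ˡ xs c f)) (sym (*-distribˡ-+ c (f x) _))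

𝟙-yes : {A : Set} (a? : Dec A) → A → 𝟙 ⌊ a? ⌋ ≡ 1
𝟙-yes (yes _) _ = refl
𝟙-yes (no ¬a) a = contradiction a ¬a

𝟙-no : {A : Set} (a? : Dec A) → ¬ A → 𝟙 ⌊ a? ⌋ ≡ 0
𝟙-no (yes a) ¬a = contradiction a ¬a
𝟙-no (no _)  _  = refl

𝟙-suc<suc : ∀ m n → 𝟙 ⌊ suc m <? suc n ⌋ ≡ 𝟙 ⌊ m <? n ⌋
𝟙-suc<suc m n with m <? n
... | yes m<n = 𝟙-yes (suc m <? suc n) (s<s m<n)
... | no  m≮n = 𝟙-no (suc m <? suc n) (m≮n ∘ s<s⁻¹)

𝟙-mono : {A B : Set} (a? : Dec A) (b? : Dec B) → (A → B) → 𝟙 ⌊ a? ⌋ ≤ 𝟙 ⌊ b? ⌋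
𝟙-mono (yes a) (yes _) _   = ≤-refl
𝟙-mono (yes a) (no ¬b) a→b = contradiction (a→b a) ¬b
𝟙-mono (no _)  _       _   = z≤n

𝟙b*m≤m : ∀ b m → 𝟙 b * m ≤ m
𝟙b*m≤m true  m = ≤-reflexive (+-identityʳ m)
𝟙b*m≤m false m = z≤n

m*𝟙b≤m : ∀ m b → m * 𝟙 b ≤ m
m*𝟙b≤m m b = subst (_≤ m) (*-comm (𝟙 b) m) (𝟙b*m≤m b m)

sum-tabulate : ∀ n (f : Fin n → ℕ) → sum (tabulate f) ≡ ∑ f
sum-tabulate zero    f = refl
sum-tabulate (suc n) f = cong (f Fin.zero +_) (sum-tabulate n (f ∘ Fin.suc))

Σ[d]≡∑ : ∀ n (f : Fin n → ℕ) → Σ[d] n f ≡ ∑ f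
Σ[d]≡∑ n f = trans (cong sum (map-tabulate (λ a → a) f)) (sum-tabulate n f)

Σ[d]-permute : ∀ n (ρ : Permutation′ n) (f : Fin n → ℕ) →
               Σ[d] n (λ a → f (ρ ⟨$⟩ʳ a)) ≡ Σ[d] n f
Σ[d]-permute n ρ f = begin
  Σ[d] n (λ a → f (ρ ⟨$⟩ʳ a)) ≡⟨ Σ[d]≡∑ n _ ⟩
  ∑ (λ a → f (ρ ⟨$⟩ʳ a))      ≡⟨ sum-permute f ρ ⟨
  ∑ f                          ≡⟨ Σ[d]≡∑ n f ⟨
  Σ[d] n f                     ∎
  where open ≡-Reasoning

∑-toℕ< : ∀ n r → r ≤ n → ∑ (λ (p : Fin n) → 𝟙 ⌊ toℕ p <? r ⌋) ≡ r
∑-toℕ< zero    zero    _         = refl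
∑-toℕ< (suc n) zero    _         = ∑-toℕ< n zero z≤n
∑-toℕ< (suc n) (suc r) (s≤s r≤n) =
  cong suc (trans (sum-cong-≗ {n} (λ p → 𝟙-suc<suc (toℕ p) r)) (∑-toℕ< n r r≤n))

Σ[d]-toℕ< : ∀ n r → r ≤ n → Σ[d] n (λ p → 𝟙 ⌊ toℕ p <? r ⌋) ≡ r
Σ[d]-toℕ< n r r≤n = trans (Σ[d]≡∑ n _) (∑-toℕ< n r r≤n)

Σ[d]-rank< : ∀ {n} (ρ : Ranking n) r → r ≤ n → Σ[d] n (λ a → 𝟙 ⌊ rank ρ a <? r ⌋) ≡ r
Σ[d]-rank< {n} ρ r r≤n =
  trans (Σ[d]-permute n ρ (λ p → 𝟙 ⌊ toℕ p <? r ⌋)) (Σ[d]-toℕ< n r r≤n)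

∣m-n∣≡m∸n+n∸m : ∀ m n → ∣ m - n ∣ ≡ (m ∸ n) + (n ∸ m)
∣m-n∣≡m∸n+n∸m zero    zero    = refl
∣m-n∣≡m∸n+n∸m zero    (suc n) = refl
∣m-n∣≡m∸n+n∸m (suc m) zero    = sym (+-identityʳ (suc m))
∣m-n∣≡m∸n+n∸m (suc m) (suc n) = ∣m-n∣≡m∸n+n∸m m n

m∸n+n≡n∸m+m : ∀ m n → (m ∸ n) + n ≡ (n ∸ m) + m
m∸n+n≡n∸m+m zero    zero    = refl
m∸n+n≡n∸m+m zero    (suc n) = sym (+-identityʳ (suc n))
m∸n+n≡n∸m+m (suc m) zero    = +-identityʳ (suc m)
m∸n+n≡n∸m+m (suc m) (suc n) = begin
  m ∸ n + suc n   ≡⟨ +-suc (m ∸ n) n ⟩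
  suc (m ∸ n + n) ≡⟨ cong suc (m∸n+n≡n∸m+m m n) ⟩
  suc (n ∸ m + m) ≡⟨ +-suc (n ∸ m) m ⟨
  n ∸ m + suc m   ∎
  where open ≡-Reasoning

[m∸n]*𝟙[n<m]≡m∸n : ∀ m n → (m ∸ n) * 𝟙 ⌊ n <? m ⌋ ≡ m ∸ n
[m∸n]*𝟙[n<m]≡m∸n m n with n <? m
... | yes _   = *-identityʳ (m ∸ n)
... | no  n≮m = trans (*-zeroʳ (m ∸ n)) (sym (m≤n⇒m∸n≡0 (≮⇒≥ n≮m)))

lateness : ∀ {d} → Ranking d → Ranking d → ℕ
lateness {d} ρ π = Σ[d] d (λ i → rank ρ i ∸ rank π i)

lateness-comm : ∀ {d} (ρ π : Ranking d) → lateness ρ π ≡ lateness π ρ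
lateness-comm {d} ρ π = +-cancelʳ-≡ (Σ[d] d (rank π)) (lateness ρ π) (lateness π ρ) (begin
  lateness ρ π + Σ[d] d (rank π)
    ≡⟨ sum-map-+ (allFin d) _ _ ⟨
  Σ[d] d (λ i → (rank ρ i ∸ rank π i) + rank π i)
    ≡⟨ sum-map-cong (allFin d) (λ i → m∸n+n≡n∸m+m (rank ρ i) (rank π i)) ⟩
  Σ[d] d (λ i → (rank π i ∸ rank ρ i) + rank ρ i)
    ≡⟨ sum-map-+ (allFin d) _ _ ⟩
  lateness π ρ + Σ[d] d (rank ρ)
    ≡⟨ cong (lateness π ρ +_) Σρ≡Σπ ⟩
  lateness π ρ + Σ[d] d (rank π)
    ∎)
  where
  open ≡-Reasoning
  Σρ≡Σπ : Σ[d] d (rank ρ) ≡ Σ[d] d (rank π)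
  Σρ≡Σπ = trans (Σ[d]-permute d ρ toℕ) (sym (Σ[d]-permute d π toℕ))

F≡2*lateness : ∀ {d} (π σ : Ranking d) → F π σ ≡ 2 * lateness σ π
F≡2*lateness {d} π σ = begin
  F π σ
    ≡⟨ sum-map-cong (allFin d) (λ i → ∣m-n∣≡m∸n+n∸m (rank π i) (rank σ i)) ⟩
  Σ[d] d (λ i → (rank π i ∸ rank σ i) + (rank σ i ∸ rank π i))
    ≡⟨ sum-map-+ (allFin d) _ _ ⟩
  lateness π σ + lateness σ π
    ≡⟨ cong (_+ lateness σ π) (lateness-comm π σ) ⟩
  lateness σ π + lateness σ π
    ≡⟨ cong (lateness σ π +_) (+-identityʳ _) ⟨
  2 * lateness σ π
    ∎
  where open ≡-Reasoning

σCost≡2*Σlateness : ∀ {d} (S : List (Ranking d)) (ρ : Ranking d) →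
                    σCost S ρ ≡ 2 * ΣS S (lateness ρ)
σCost≡2*Σlateness {d} S ρ = cong (2 *_) (sum-map-cong S (λ π →
  sum-map-cong (allFin d) (λ i → [m∸n]*𝟙[n<m]≡m∸n (rank ρ i) (rank π i))))

Obj≡σCost : ∀ {d} (S : List (Ranking d)) (ρ : Ranking d) → Obj S ρ ≡ σCost S ρ
Obj≡σCost S ρ = begin
  Obj S ρ                      ≡⟨ sum-map-cong S (λ π → F≡2*lateness π ρ) ⟩
  ΣS S (λ π → 2 * lateness ρ π) ≡⟨ sum-map-*ˡ S 2 (lateness ρ) ⟩
  2 * ΣS S (lateness ρ)        ≡⟨ σCost≡2*Σlateness S ρ ⟨
  σCost S ρ                    ∎
  where open ≡-Reasoning

⟨$⟩ʳ-injective : ∀ {n} (ρ : Permutation′ n) → Injective _≡_ _≡_ (ρ ⟨$⟩ʳ_)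
⟨$⟩ʳ-injective ρ = Injection.injective (↔⇒↣ ρ)

injective⇒surjective : ∀ {n} (f : Fin n → Fin n) → Injective _≡_ _≡_ f →
                       ∀ y → ∃ λ x → f x ≡ y
injective⇒surjective {suc n} f f-injective y with any? (λ x → f x Fin.≟ y)
... | yes hit  = hit
... | no  miss = contradiction (injective⇒≤ skip-injective) (1+n≰n {n})
  where
  y≢f : ∀ x → y ≢ f x
  y≢f x y≡fx = miss (x , sym y≡fx)
  skip : Fin (suc n) → Fin n
  skip x = punchOut (y≢f x)
  skip-injective : Injective _≡_ _≡_ skip
  skip-injective {a} {b} = f-injective ∘ punchOut-injective (y≢f a) (y≢f b)

permutationOfInjection : ∀ {n} (f : Fin n → Fin n) → Injective _≡_ _≡_ f → Permutation′ n
permutationOfInjection f f-injective = permutation f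
  (proj₁ ∘ injective⇒surjective f f-injective)
  (proj₂ ∘ injective⇒surjective f f-injective)
  (λ x → f-injective (proj₂ (injective⇒surjective f f-injective (f x))))

+-cancelˡ-≤ℤ : ∀ i {j k : ℤ} → i ℤ.+ j ℤ.≤ i ℤ.+ k → j ℤ.≤ k
+-cancelˡ-≤ℤ i {j} {k} i+j≤i+k =
  subst₂ ℤ._≤_ (-i+[i+x]≡x i j) (-i+[i+x]≡x i k) (ℤₚ.+-monoʳ-≤ (ℤ.- i) i+j≤i+k)
  where
  -i+[i+x]≡x : ∀ i x → ℤ.- i ℤ.+ (i ℤ.+ x) ≡ x
  -i+[i+x]≡x = solve-∀

i+j-k≤i⇔j≤k : ∀ (i j k : ℤ) → (i ℤ.+ j ℤ.- k ℤ.≤ i) ⇔ (j ℤ.≤ k)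
i+j-k≤i⇔j≤k i j k = mk⇔
  (λ h → ℤₚ.i-j≤0⇒i≤j (+-cancelˡ-≤ℤ i (subst₂ ℤ._≤_ assoc (sym (ℤₚ.+-identityʳ i)) h)))
  (λ h → subst₂ ℤ._≤_ (sym assoc) (ℤₚ.+-identityʳ i) (ℤₚ.+-monoʳ-≤ i (ℤₚ.i≤j⇒i-j≤0 h)))
  where
  assoc : i ℤ.+ j ℤ.- k ≡ i ℤ.+ (j ℤ.- k)
  assoc = ℤₚ.+-assoc i j (ℤ.- k)

i≤i+j-k⇔k≤j : ∀ (i j k : ℤ) → (i ℤ.≤ i ℤ.+ j ℤ.- k) ⇔ (k ℤ.≤ j)
i≤i+j-k⇔k≤j i j k = mk⇔
  (λ h → ℤₚ.0≤i-j⇒j≤i (+-cancelˡ-≤ℤ i (subst₂ ℤ._≤_ (sym (ℤₚ.+-identityʳ i)) assoc h)))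
  (λ h → subst₂ ℤ._≤_ (ℤₚ.+-identityʳ i) (sym assoc) (ℤₚ.+-monoʳ-≤ i (ℤₚ.i≤j⇒0≤j-i h)))
  where
  assoc : i ℤ.+ j ℤ.- k ≡ i ℤ.+ (j ℤ.- k)
  assoc = ℤₚ.+-assoc i j (ℤ.- k)

bounds⇔complement-bounds : ∀ (n D R f c : ℤ) → n ≡ D ℤ.+ R →
  ((f ℤ.≤ R) × (R ℤ.≤ c)) ⇔ ((n ℤ.- c ℤ.≤ D) × (D ℤ.≤ n ℤ.- f))
bounds⇔complement-bounds _ D R f c refl = mk⇔
  (λ (f≤R , R≤c) →
     Equivalence.from (i+j-k≤i⇔j≤k D R c) R≤c , Equivalence.from (i≤i+j-k⇔k≤j D R f) f≤R)
  (λ (lower , upper) →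
     Equivalence.to (i≤i+j-k⇔k≤j D R f) upper , Equivalence.to (i+j-k≤i⇔j≤k D R c) lower)

DomainIsBottomOf : ∀ {d k} → BottomRanking d k → Ranking d → Set
DomainIsBottomOf {d} {k} T ρ = ∀ (a : Fin d) → inD T a + 𝟙 ⌊ rank ρ a <? k ⌋ ≡ 1

module _ {d g k : ℕ} (grp : Fin d → Fin g) (T : BottomRanking d k) (ρ : Ranking d)
         (T-bottom : DomainIsBottomOf T ρ) where

  domCount+topCount≡groupSize : ∀ j → domCount grp T j + topCount grp k ρ j ≡ groupSize grp j
  domCount+topCount≡groupSize j = begin
    domCount grp T j + topCount grp k ρ j
      ≡⟨ sum-map-+ (allFin d) _ _ ⟨
    Σ[d] d (λ a → [a∈Gj] a * inD T a + [a∈Gj] a * 𝟙 ⌊ rank ρ a <? k ⌋)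
      ≡⟨ sum-map-cong (allFin d) split ⟩
    groupSize grp j
      ∎
    where
    open ≡-Reasoning
    [a∈Gj] : Fin d → ℕ
    [a∈Gj] a = 𝟙 ⌊ grp a Fin.≟ j ⌋
    split : ∀ a → [a∈Gj] a * inD T a + [a∈Gj] a * 𝟙 ⌊ rank ρ a <? k ⌋ ≡ [a∈Gj] a
    split a = trans (sym (*-distribˡ-+ ([a∈Gj] a) _ _))
                    (trans (cong ([a∈Gj] a *_) (T-bottom a)) (*-identityʳ _))

  fair⇔tauFeasible : (α β : Fin g → ℚ) → Fair grp α β k ρ ⇔ TauFeasible grp α β T
  fair⇔tauFeasible α β = mk⇔
    (λ fair j → Equivalence.to (bounds⇔complement-bounds _ _ _ _ _ (size≡ j)) (fair j))
    (λ feasible j → Equivalence.from (bounds⇔complement-bounds _ _ _ _ _ (size≡ j)) (feasible j))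
    where
    size≡ : ∀ j → ℤ.+ groupSize grp j ≡ ℤ.+ domCount grp T j ℤ.+ ℤ.+ topCount grp k ρ j
    size≡ j = cong ℤ.+_ (sym (domCount+topCount≡groupSize j))

module Extension {d k : ℕ} (T : BottomRanking d k) (σ : Ranking d) (σ-extends : Extends σ T) where

  extends⇒rank<k : ∀ a → τ T a ≡ nothing → rank σ a < k
  extends⇒rank<k a τa≡nothing with k ≤? rank σ a
  ... | no  k≰σa = ≰⇒> k≰σa
  ... | yes k≤σa with surjective T (σ ⟨$⟩ʳ a) k≤σa
  ...   | b , τb≡σa with ⟨$⟩ʳ-injective σ (σ-extends b (σ ⟨$⟩ʳ a) τb≡σa)
  ...     | refl = contradiction (trans (sym τa≡nothing) τb≡σa) λ ()

  extends⇒k≤rank : ∀ a p → τ T a ≡ just p → k ≤ rank σ a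
  extends⇒k≤rank a p τa≡p =
    subst (k ≤_) (cong toℕ (sym (σ-extends a p τa≡p))) (inBottom T a p τa≡p)

  extends⇒domainIsBottomOf : DomainIsBottomOf T σ
  extends⇒domainIsBottomOf a with τ T a in τa
  ... | just p  = cong suc (𝟙-no (rank σ a <? k) (≤⇒≯ (extends⇒k≤rank a p τa)))
  ... | nothing = 𝟙-yes (rank σ a <? k) (extends⇒rank<k a τa)

module _ {d : ℕ} (k : ℕ) (ρ : Ranking d) where

  bottomPart : Fin d → Maybe (Fin d)
  bottomPart a with k ≤? rank ρ a
  ... | yes _ = just (ρ ⟨$⟩ʳ a)
  ... | no  _ = nothing

  bottomPart≡just : ∀ a p → bottomPart a ≡ just p → ρ ⟨$⟩ʳ a ≡ p × k ≤ toℕ p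
  bottomPart≡just a p bottomPart-a with k ≤? rank ρ a | bottomPart-a
  ... | yes k≤ρa | refl = refl , k≤ρa

  bottomPart-surjective : ∀ p → k ≤ toℕ p → bottomPart (ρ ⟨$⟩ˡ p) ≡ just p
  bottomPart-surjective p k≤p with k ≤? rank ρ (ρ ⟨$⟩ˡ p)
  ... | yes _    = cong just (inverseʳ ρ)
  ... | no  k≰ρa = contradiction (subst (λ q → k ≤ toℕ q) (sym (inverseʳ ρ)) k≤p) k≰ρa

  bottomOf : BottomRanking d k
  bottomOf = record
    { τ          = bottomPart
    ; injective  = λ a b p τa τb →
        ⟨$⟩ʳ-injective ρ (trans (proj₁ (bottomPart≡just a p τa))
                                (sym (proj₁ (bottomPart≡just b p τb))))
    ; inBottom   = λ a p τa → proj₂ (bottomPart≡just a p τa)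
    ; surjective = λ p k≤p → ρ ⟨$⟩ˡ p , bottomPart-surjective p k≤p
    }

  bottomOf-domainIsBottomOf : DomainIsBottomOf bottomOf ρ
  bottomOf-domainIsBottomOf a with k ≤? rank ρ a
  ... | yes k≤ρa = cong suc (𝟙-no (rank ρ a <? k) (≤⇒≯ k≤ρa))
  ... | no  k≰ρa = 𝟙-yes (rank ρ a <? k) (≰⇒> k≰ρa)

  τCost-bottomOf : (S : List (Ranking d)) → τCost S bottomOf ≡ bottomCost S k ρ
  τCost-bottomOf S = cong (2 *_) (sum-map-cong S (λ π → sum-map-cong (allFin d) (bottomTerm π)))
    where
    bottomTerm : ∀ π a → τCostTerm bottomOf π a ≡
      𝟙 ⌊ k ≤? rank ρ a ⌋ * ((rank ρ a ∸ rank π a) * 𝟙 ⌊ rank π a <? rank ρ a ⌋)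
    bottomTerm π a with k ≤? rank ρ a
    ... | yes _ = sym (+-identityʳ _)
    ... | no  _ = refl

-- Keep the bottom of ρ and rearrange its top k candidates in the order of σ*.
module ReorderTop {d k : ℕ} (k≤d : k ≤ d) (ρ σ* : Ranking d) where

  inTop : Fin d → ℕ
  inTop b = 𝟙 ⌊ rank ρ b <? k ⌋

  topRank : Fin d → ℕ
  topRank a = Σ[d] d (λ b → inTop b * 𝟙 ⌊ rank σ* b <? rank σ* a ⌋)

  topRank≤rank : ∀ a → topRank a ≤ rank σ* a
  topRank≤rank a = begin
    topRank a
      ≤⟨ sum-map-mono (allFin d) (λ b → 𝟙b*m≤m ⌊ rank ρ b <? k ⌋ _) ⟩
    Σ[d] d (λ b → 𝟙 ⌊ rank σ* b <? rank σ* a ⌋)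
      ≡⟨ Σ[d]-rank< σ* (rank σ* a) (<⇒≤ (toℕ<n (σ* ⟨$⟩ʳ a))) ⟩
    rank σ* a
      ∎
    where open ≤-Reasoning

  topRank<d : ∀ a → topRank a < d
  topRank<d a = ≤-<-trans (topRank≤rank a) (toℕ<n (σ* ⟨$⟩ʳ a))

  topRank<k : ∀ a → rank ρ a < k → topRank a < k
  topRank<k a ρa<k = subst (topRank a <_) (Σ[d]-rank< ρ k k≤d)
    (sum-map-< (allFin d) (λ b → m*𝟙b≤m _ _) (∈-allFin a) own-term)
    where
    own-term : inTop a * 𝟙 ⌊ rank σ* a <? rank σ* a ⌋ < inTop a
    own-term rewrite 𝟙-yes (rank ρ a <? k) ρa<k
                   | 𝟙-no (rank σ* a <? rank σ* a) (<-irrefl refl) = s≤s z≤n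

  topRank-strictMono : ∀ a b → rank ρ a < k → rank σ* a < rank σ* b → topRank a < topRank b
  topRank-strictMono a b ρa<k σ*a<σ*b = sum-map-< (allFin d)
    (λ c → *-monoʳ-≤ (inTop c) (𝟙-mono (rank σ* c <? rank σ* a) (rank σ* c <? rank σ* b)
                                        (λ σ*c<σ*a → <-trans σ*c<σ*a σ*a<σ*b)))
    (∈-allFin a) own-term
    where
    own-term : inTop a * 𝟙 ⌊ rank σ* a <? rank σ* a ⌋ < inTop a * 𝟙 ⌊ rank σ* a <? rank σ* b ⌋
    own-term rewrite 𝟙-yes (rank ρ a <? k) ρa<k | 𝟙-no (rank σ* a <? rank σ* a) (<-irrefl refl)
                   | 𝟙-yes (rank σ* a <? rank σ* b) σ*a<σ*b = s≤s z≤n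

  topRank-injective : ∀ {a b} → rank ρ a < k → rank ρ b < k → topRank a ≡ topRank b → a ≡ b
  topRank-injective {a} {b} ρa<k ρb<k eq with <-cmp (rank σ* a) (rank σ* b)
  ... | tri< σ*a<σ*b _ _ = contradiction eq (<⇒≢ (topRank-strictMono a b ρa<k σ*a<σ*b))
  ... | tri≈ _ σ*a≡σ*b _ = ⟨$⟩ʳ-injective σ* (toℕ-injective σ*a≡σ*b)
  ... | tri> _ _ σ*b<σ*a = contradiction (sym eq) (<⇒≢ (topRank-strictMono b a ρb<k σ*b<σ*a))

  reorder : Fin d → Fin d
  reorder a with k ≤? rank ρ a
  ... | yes _ = ρ ⟨$⟩ʳ a
  ... | no  _ = fromℕ< (topRank<d a)

  bottom≢top : ∀ {a b} → k ≤ rank ρ a → rank ρ b < k → ρ ⟨$⟩ʳ a ≢ fromℕ< (topRank<d b)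
  bottom≢top {a} {b} k≤ρa ρb<k eq = <⇒≱ (topRank<k b ρb<k)
    (≤-trans k≤ρa (≤-reflexive (trans (cong toℕ eq) (toℕ-fromℕ< (topRank<d b)))))

  reorder-injective : Injective _≡_ _≡_ reorder
  reorder-injective {a} {b} eq with k ≤? rank ρ a | k ≤? rank ρ b
  ... | yes _    | yes _    = ⟨$⟩ʳ-injective ρ eq
  ... | yes k≤ρa | no  k≰ρb = contradiction eq (bottom≢top k≤ρa (≰⇒> k≰ρb))
  ... | no  k≰ρa | yes k≤ρb = contradiction (sym eq) (bottom≢top k≤ρb (≰⇒> k≰ρa))
  ... | no  k≰ρa | no  k≰ρb = topRank-injective (≰⇒> k≰ρa) (≰⇒> k≰ρb)
    (trans (sym (toℕ-fromℕ< (topRank<d a))) (trans (cong toℕ eq) (toℕ-fromℕ< (topRank<d b))))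

  reordered : Ranking d
  reordered = permutationOfInjection reorder reorder-injective

  reordered-bottom : ∀ a → k ≤ rank ρ a → reordered ⟨$⟩ʳ a ≡ ρ ⟨$⟩ʳ a
  reordered-bottom a k≤ρa with k ≤? rank ρ a
  ... | yes _    = refl
  ... | no  k≰ρa = contradiction k≤ρa k≰ρa

  reordered-top : ∀ a → rank ρ a < k → rank reordered a ≤ rank σ* a
  reordered-top a ρa<k with k ≤? rank ρ a
  ... | yes k≤ρa = contradiction ρa<k (≤⇒≯ k≤ρa)
  ... | no  _    = subst (_≤ rank σ* a) (sym (toℕ-fromℕ< (topRank<d a))) (topRank≤rank a)

module Completion {d k : ℕ} (k≤d : k ≤ d) (T : BottomRanking d k) (σ : Ranking d)
         (σ-extends : Extends σ T) (σ* : Ranking d) where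

  open Extension T σ σ-extends
  open ReorderTop k≤d σ σ* public using (reordered)
  open ReorderTop k≤d σ σ* using (reordered-bottom; reordered-top)

  reordered-extends : Extends reordered T
  reordered-extends a p τa≡p =
    trans (reordered-bottom a (extends⇒k≤rank a p τa≡p)) (σ-extends a p τa≡p)

  lateness-reordered : ∀ π → lateness reordered π ≤ Σ[d] d (τCostTerm T π) + lateness σ* π
  lateness-reordered π = begin
    lateness reordered π
      ≤⟨ sum-map-mono (allFin d) latenessAt ⟩
    Σ[d] d (λ a → τCostTerm T π a + (rank σ* a ∸ rank π a))
      ≡⟨ sum-map-+ (allFin d) (τCostTerm T π) _ ⟩
    Σ[d] d (τCostTerm T π) + lateness σ* π
      ∎
    where
    open ≤-Reasoning
    latenessAt : ∀ a → rank reordered a ∸ rank π a ≤ τCostTerm T π a + (rank σ* a ∸ rank π a)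
    latenessAt a with τ T a in τa
    ... | just p  = begin
      rank reordered a ∸ rank π a
        ≡⟨ cong (λ q → toℕ q ∸ rank π a) (reordered-extends a p τa) ⟩
      toℕ p ∸ rank π a
        ≡⟨ [m∸n]*𝟙[n<m]≡m∸n (toℕ p) (rank π a) ⟨
      (toℕ p ∸ rank π a) * 𝟙 ⌊ rank π a <? toℕ p ⌋
        ≤⟨ m≤m+n _ (rank σ* a ∸ rank π a) ⟩
      (toℕ p ∸ rank π a) * 𝟙 ⌊ rank π a <? toℕ p ⌋ + (rank σ* a ∸ rank π a)
        ∎
    ... | nothing = ∸-monoˡ-≤ (rank π a) (reordered-top a (extends⇒rank<k a τa))

  σCost-reordered : (S : List (Ranking d)) → σCost S reordered ≤ τCost S T + σCost S σ*
  σCost-reordered S = begin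
    σCost S reordered
      ≡⟨ σCost≡2*Σlateness S reordered ⟩
    2 * ΣS S (lateness reordered)
      ≤⟨ *-monoʳ-≤ 2 (sum-map-mono S lateness-reordered) ⟩
    2 * ΣS S (λ π → Σ[d] d (τCostTerm T π) + lateness σ* π)
      ≡⟨ cong (2 *_) (sum-map-+ S _ _) ⟩
    2 * (ΣS S (λ π → Σ[d] d (τCostTerm T π)) + ΣS S (lateness σ*))
      ≡⟨ *-distribˡ-+ 2 (ΣS S (λ π → Σ[d] d (τCostTerm T π))) (ΣS S (lateness σ*)) ⟩
    τCost S T + 2 * ΣS S (lateness σ*)
      ≡⟨ cong (τCost S T +_) (σCost≡2*Σlateness S σ*) ⟨
    τCost S T + σCost S σ*
      ∎
    where open ≤-Reasoning

lemmaB3 : (d g k : ℕ) (S : List (Ranking d)) (grp : Fin d → Fin g)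
          (α β : Fin g → ℚ) →
          (∀ j → (0ℚ ℚ.≤ α j) × (α j ℚ.≤ 1ℚ)) →
          (∀ j → (0ℚ ℚ.≤ β j) × (β j ℚ.≤ 1ℚ)) →
          1 ≤ k → k ≤ d →
          (T : BottomRanking d k) → TauFeasible grp α β T →
          (∀ (T′ : BottomRanking d k) → TauFeasible grp α β T′ →
            τCost S T ≤ τCost S T′) →
          (σ : Ranking d) → Extends σ T →
          (∀ (σ′ : Ranking d) → Extends σ′ T → σCost S σ ≤ σCost S σ′) →
          (σ* : Ranking d) → Fair grp α β k σ* →
          (∀ (ρ : Ranking d) → Fair grp α β k ρ → Obj S σ* ≤ Obj S ρ) →
          Fair grp α β k σ × (Obj S σ ≤ bottomCost S k σ* + Obj S σ*)
lemmaB3 d g k S grp α β _ _ _ k≤d T T-feasible T-minimal σ σ-extends σ-minimal σ* σ*-fair _ =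
  Equivalence.from (fair⇔tauFeasible grp T σ extends⇒domainIsBottomOf α β) T-feasible ,
  (begin
    Obj S σ                             ≡⟨ Obj≡σCost S σ ⟩
    σCost S σ                           ≤⟨ σ-minimal reordered reordered-extends ⟩
    σCost S reordered                   ≤⟨ σCost-reordered S ⟩
    τCost S T + σCost S σ*              ≤⟨ +-monoˡ-≤ (σCost S σ*) (T-minimal T* T*-feasible) ⟩
    τCost S T* + σCost S σ*             ≡⟨ cong₂ _+_ (τCost-bottomOf k σ* S) (sym (Obj≡σCost S σ*)) ⟩
    bottomCost S k σ* + Obj S σ*        ∎)
  where
  open ≤-Reasoning
  open Extension T σ σ-extends
  open Completion k≤d T σ σ-extends σ*
  T* : BottomRanking d k
  T* = bottomOf k σ*
  T*-feasible : TauFeasible grp α β T*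
  T*-feasible = Equivalence.to (fair⇔tauFeasible grp T* σ* (bottomOf-domainIsBottomOf k σ*) α β) σ*-fair
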